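{- Let $t\geq 1$ and let $p_1<p_2<\cdots<p_t$ be distinct primes. Then $$\phi(p_1p_2\cdots p_t)-p_1p_2\cdots p_t+\sum_{k=1}^{t}\frac{p_1p_2\cdots p_t}{p_k}\geq 0,$$ with equality if and only if $t=1$.
   Context: $\phi$ is Euler's totient function. -}

module Defs where

open import Data.Nat using (ℕ; zero; suc; _/_; _≟_)
open import Data.Nat.GCD using (gcd)
open import Data.Nat.Primality using (Prime; prime⇒nonZero)
open import Data.List using (List; length; filter; upTo; map)

φ : ℕ → ℕ
φ n = length (filter (λ k → gcd k n ≟ 1) (map suc (upTo n)))

divByPrime : (n p : ℕ) → Prime p → ℕ
divByPrime n p pp = _/_ n p {{prime⇒nonZero pp}}

-- For 1 ≤ k ≤ N = p₁⋯pₜ, either k is coprime to N or some pᵢ divides k, so the number of the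
-- conditions "gcd(k, N) = 1", "p₁ ∣ k", …, "pₜ ∣ k" that k satisfies is at least 1.  Summing over k
-- gives N ≤ φ(N) + Σᵢ #{k ≤ N : pᵢ ∣ k} = φ(N) + Σᵢ N/pᵢ.  For t ≥ 2, k = N satisfies at least two
-- conditions, so the inequality is strict; for t = 1 it is φ(p) + 1 = p.
module Submission where

open import Defs
open import Data.Nat using (ℕ; _<_)
open import Data.Nat.Primality using (Prime)
open import Data.Fin using (Fin)
import Data.Fin as F
open import Data.Vec.Functional using (foldr)
open import Data.Integer using (ℤ; +_; _+_; _-_; _≤_; 0ℤ)
open import Relation.Binary.PropositionalEquality using (_≡_)
open import Function.Bundles using (_⇔_)
open import Data.Product using (_×_)

import Data.Nat as ℕ
open import Data.Nat using (zero; suc; NonZero; nonTrivial⇒n>1; _∸_; _/_; _≟_; z≤n; s≤s)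
open import Data.Nat.Properties
open import Data.Nat.Divisibility using (_∣_; _∣?_; ∣-trans; ∣-refl; m∣m*n; n∣m*n; divides)
open import Data.Nat.DivMod using (m*n/n≡m; m<n*o⇒m/o<n; /-monoˡ-≤; n/n≡1)
open import Data.Nat.GCD using (gcd)
open import Data.Nat.Coprimality as Coprimality
  using (Coprime; coprime⇒gcd≡1; gcd≡1⇒coprime; coprime-divisor; 1-coprimeTo)
open import Data.Nat.Primality using (prime⇒irreducible; prime⇒nonZero; prime⇒nonTrivial)
open import Data.Fin.Properties using (any?)
open import Data.Vec.Functional using (Vector)
open import Data.List using ([_]; _++_; _∷ʳ_; filter; length; map; upTo)
open import Data.List.Properties using (upTo-∷ʳ; map-++; filter-++; length-++)
open import Data.Integer using (-_; _⊖_; +≤+)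
open import Data.Integer.Properties using (pos-+; [+m]-[+n]≡m⊖n; ⊖-≥; +-injective)
import Data.Integer.Properties as ℤ
open import Data.Product using (_,_)
open import Data.Sum using (inj₁; inj₂)
open import Function using (_∘_)
open import Function.Bundles using (mk⇔; module Equivalence)
open import Relation.Nullary using (Dec; yes; no; ¬_; contradiction)
open import Relation.Unary using (Pred; Decidable)
open import Relation.Binary.PropositionalEquality using (_≢_; refl; sym; trans; cong; cong₂; subst; module ≡-Reasoning)
open import Algebra.Properties.CommutativeMonoid.Sum +-0-commutativeMonoid
  using (sum; sum-syntax; ∑-distrib-+; sum-replicate-zero)
open import Algebra.Properties.CommutativeSemigroup +-commutativeSemigroup using (interchange)
open import Algebra.Properties.CommutativeSemigroup ℤ.+-commutativeSemigroup using (xy∙z≈xz∙y)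

𝟙 : ∀ {p} {P : Set p} → Dec P → ℕ
𝟙 (yes _) = 1
𝟙 (no _)  = 0

𝟙≤1 : ∀ {p} {P : Set p} (d : Dec P) → 𝟙 d ℕ.≤ 1
𝟙≤1 (yes _) = ≤-refl
𝟙≤1 (no _)  = z≤n

1≤𝟙 : ∀ {p} {P : Set p} (d : Dec P) → P → 1 ℕ.≤ 𝟙 d
1≤𝟙 (yes _) _ = ≤-refl
1≤𝟙 (no ¬P) P = contradiction P ¬P

𝟙-no : ∀ {p} {P : Set p} (d : Dec P) → ¬ P → 𝟙 d ≡ 0
𝟙-no (yes P) ¬P = contradiction P ¬P
𝟙-no (no _)  _  = refl

sumTo : ℕ → (ℕ → ℕ) → ℕ
sumTo zero    f = 0
sumTo (suc n) f = sumTo n f ℕ.+ f (suc n)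

sumTo-+ : ∀ n (f g : ℕ → ℕ) → sumTo n (λ k → f k ℕ.+ g k) ≡ sumTo n f ℕ.+ sumTo n g
sumTo-+ zero    f g = refl
sumTo-+ (suc n) f g = trans (cong (ℕ._+ (f (suc n) ℕ.+ g (suc n))) (sumTo-+ n f g))
                            (interchange (sumTo n f) (sumTo n g) (f (suc n)) (g (suc n)))

sumTo-mono-≤ : ∀ n {f g : ℕ → ℕ} → (∀ k → f k ℕ.≤ g k) → sumTo n f ℕ.≤ sumTo n g
sumTo-mono-≤ zero    f≤g = z≤n
sumTo-mono-≤ (suc n) f≤g = +-mono-≤ (sumTo-mono-≤ n f≤g) (f≤g (suc n))

sumTo-1 : ∀ n → sumTo n (λ _ → 1) ≡ n
sumTo-1 zero    = refl
sumTo-1 (suc n) = trans (cong (ℕ._+ 1) (sumTo-1 n)) (+-comm n 1)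

n≤sumTo : ∀ n {f : ℕ → ℕ} → (∀ k → 1 ℕ.≤ f k) → n ℕ.≤ sumTo n f
n≤sumTo n {f} 1≤f = subst (ℕ._≤ sumTo n f) (sumTo-1 n) (sumTo-mono-≤ n 1≤f)

sumTo≤n : ∀ n {f : ℕ → ℕ} → (∀ k → f k ℕ.≤ 1) → sumTo n f ℕ.≤ n
sumTo≤n n {f} f≤1 = subst (sumTo n f ℕ.≤_) (sumTo-1 n) (sumTo-mono-≤ n f≤1)

n<sumTo : ∀ n .{{_ : NonZero n}} {f : ℕ → ℕ} → (∀ k → 1 ℕ.≤ f k) → 2 ℕ.≤ f n → n < sumTo n f
n<sumTo (suc n) 1≤f 2≤fn = ≤-trans (≤-reflexive (+-comm 2 n)) (+-mono-≤ (n≤sumTo n 1≤f) 2≤fn)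

sumTo-∑-comm : ∀ {t} n (f : Fin t → ℕ → ℕ) →
               sumTo n (λ k → ∑[ i < t ] f i k) ≡ ∑[ i < t ] sumTo n (f i)
sumTo-∑-comm {t} zero    f = sym (sum-replicate-zero t)
sumTo-∑-comm     (suc n) f = trans (cong (ℕ._+ sum (λ i → f i (suc n))) (sumTo-∑-comm n f))
                                   (sym (∑-distrib-+ (λ i → sumTo n (f i)) (λ i → f i (suc n))))

length-filter-upTo : ∀ {p} {P : Pred ℕ p} (P? : Decidable P) n →
                     length (filter P? (map suc (upTo n))) ≡ sumTo n (𝟙 ∘ P?)
length-filter-upTo P? zero    = refl
length-filter-upTo P? (suc n) = begin
  length (filter P? (map suc (upTo (suc n))))
    ≡⟨ cong (length ∘ filter P? ∘ map suc) (sym (upTo-∷ʳ n)) ⟩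
  length (filter P? (map suc (upTo n ∷ʳ n)))
    ≡⟨ cong (length ∘ filter P?) (map-++ suc (upTo n) [ n ]) ⟩
  length (filter P? (map suc (upTo n) ++ [ suc n ]))
    ≡⟨ cong length (filter-++ P? (map suc (upTo n)) [ suc n ]) ⟩
  length (filter P? (map suc (upTo n)) ++ filter P? [ suc n ])
    ≡⟨ length-++ (filter P? (map suc (upTo n))) ⟩
  length (filter P? (map suc (upTo n))) ℕ.+ length (filter P? [ suc n ])
    ≡⟨ cong₂ ℕ._+_ (length-filter-upTo P? n) (length-filter-[x] (suc n)) ⟩
  sumTo n (𝟙 ∘ P?) ℕ.+ 𝟙 (P? (suc n)) ∎
  where
  open ≡-Reasoning
  length-filter-[x] : ∀ x → length (filter P? [ x ]) ≡ 𝟙 (P? x)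
  length-filter-[x] x with P? x
  ... | yes _ = refl
  ... | no _  = refl

φ≡sumTo : ∀ n → φ n ≡ sumTo n (λ k → 𝟙 (gcd k n ≟ 1))
φ≡sumTo n = length-filter-upTo (λ k → gcd k n ≟ 1) n

φ<n : ∀ n → 1 < n → φ n < n
φ<n (suc n) (s≤s 1≤n) = s≤s (begin
  φ (suc n)                                 ≡⟨ φ≡sumTo (suc n) ⟩
  sumTo n coprime ℕ.+ coprime (suc n)       ≡⟨ cong (sumTo n coprime ℕ.+_) (𝟙-no (gcd (suc n) (suc n) ≟ 1) gcd[n,n]≢1) ⟩
  sumTo n coprime ℕ.+ 0                     ≡⟨ +-identityʳ _ ⟩
  sumTo n coprime                           ≤⟨ sumTo≤n n (λ k → 𝟙≤1 (gcd k (suc n) ≟ 1)) ⟩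
  n                                         ∎)
  where
  open ≤-Reasoning
  coprime : ℕ → ℕ
  coprime k = 𝟙 (gcd k (suc n) ≟ 1)
  gcd[n,n]≢1 : gcd (suc n) (suc n) ≢ 1
  gcd[n,n]≢1 eq = <⇒≢ (s≤s 1≤n) (sym (gcd≡1⇒coprime eq (∣-refl , ∣-refl)))

#multiples≤/ : ∀ p .{{_ : NonZero p}} n → sumTo n (λ k → 𝟙 (p ∣? k)) ℕ.≤ n / p
#multiples≤/ p zero = z≤n
#multiples≤/ p (suc n) with p ∣? suc n
... | no _ = begin
  sumTo n (λ k → 𝟙 (p ∣? k)) ℕ.+ 0  ≡⟨ +-identityʳ _ ⟩
  sumTo n (λ k → 𝟙 (p ∣? k))        ≤⟨ #multiples≤/ p n ⟩
  n / p                              ≤⟨ /-monoˡ-≤ p (n≤1+n n) ⟩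
  suc n / p                          ∎
  where open ≤-Reasoning
... | yes (divides q n+1≡qp) = begin
  sumTo n (λ k → 𝟙 (p ∣? k)) ℕ.+ 1  ≤⟨ +-monoˡ-≤ 1 (#multiples≤/ p n) ⟩
  n / p ℕ.+ 1                        ≡⟨ +-comm (n / p) 1 ⟩
  suc (n / p)                        ≤⟨ m<n*o⇒m/o<n (subst (n <_) n+1≡qp (n<1+n n)) ⟩
  q                                  ≡⟨ sym (m*n/n≡m q p) ⟩
  q ℕ.* p / p                        ≡⟨ cong (_/ p) n+1≡qp ⟨
  suc n / p                          ∎
  where open ≤-Reasoning

∑-mono-≤ : ∀ {t} {f g : Vector ℕ t} → (∀ i → f i ℕ.≤ g i) → sum f ℕ.≤ sum g
∑-mono-≤ {zero}  f≤g = z≤n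
∑-mono-≤ {suc t} f≤g = +-mono-≤ (f≤g F.zero) (∑-mono-≤ (f≤g ∘ F.suc))

term≤∑ : ∀ {t} (f : Vector ℕ t) i → f i ℕ.≤ sum f
term≤∑ f F.zero    = m≤m+n (f F.zero) _
term≤∑ f (F.suc i) = ≤-trans (term≤∑ (f ∘ F.suc) i) (m≤n+m _ (f F.zero))

∏ : ∀ {t} → Vector ℕ t → ℕ
∏ = foldr ℕ._*_ 1

∣∏ : ∀ {t} (f : Vector ℕ t) i → f i ∣ ∏ f
∣∏ f F.zero    = m∣m*n _
∣∏ f (F.suc i) = ∣-trans (∣∏ (f ∘ F.suc) i) (n∣m*n (f F.zero))

∏-nonZero : ∀ {t} (f : Vector ℕ t) → (∀ i → NonZero (f i)) → NonZero (∏ f)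
∏-nonZero {zero}  f f≢0 = _
∏-nonZero {suc t} f f≢0 =
  m*n≢0 (f F.zero) (∏ (f ∘ F.suc)) {{f≢0 F.zero}} {{∏-nonZero (f ∘ F.suc) (f≢0 ∘ F.suc)}}

coprime-* : ∀ {k m n} → Coprime k m → Coprime k n → Coprime k (m ℕ.* n)
coprime-* k⊥m k⊥n (d∣k , d∣mn) =
  k⊥n (d∣k , coprime-divisor (λ (e∣d , e∣m) → k⊥m (∣-trans e∣d d∣k , e∣m)) d∣mn)

coprime-∏ : ∀ {t k} (f : Vector ℕ t) → (∀ i → Coprime k (f i)) → Coprime k (∏ f)
coprime-∏ {zero}  {k} f k⊥f = Coprimality.sym (1-coprimeTo k)
coprime-∏ {suc t}     f k⊥f = coprime-* (k⊥f F.zero) (coprime-∏ (f ∘ F.suc) (k⊥f ∘ F.suc))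

∤⇒coprime : ∀ {p k} → Prime p → ¬ p ∣ k → Coprime k p
∤⇒coprime pp p∤k (d∣k , d∣p) with prime⇒irreducible pp d∣p
... | inj₁ d≡1 = d≡1
... | inj₂ refl = contradiction d∣k p∤k

module _ {t} (p : Vector ℕ t) (pp : ∀ i → Prime (p i)) where

  cofactorSum : ℕ
  cofactorSum = ∑[ i < t ] divByPrime (∏ p) (p i) (pp i)

  coverage : ℕ → ℕ
  coverage k = 𝟙 (gcd k (∏ p) ≟ 1) ℕ.+ ∑[ i < t ] 𝟙 (p i ∣? k)

  1≤coverage : ∀ k → 1 ℕ.≤ coverage k
  1≤coverage k with any? (λ i → p i ∣? k)
  ... | yes (i , pᵢ∣k) = ≤-trans (1≤𝟙 (p i ∣? k) pᵢ∣k) (≤-trans (term≤∑ _ i) (m≤n+m _ _))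
  ... | no ∤k = ≤-trans (1≤𝟙 (gcd k (∏ p) ≟ 1) (coprime⇒gcd≡1 k⊥∏p)) (m≤m+n _ _)
    where
    k⊥∏p : Coprime k (∏ p)
    k⊥∏p = coprime-∏ p (λ i → ∤⇒coprime (pp i) (λ pᵢ∣k → ∤k (i , pᵢ∣k)))

  sumTo-coverage≤ : sumTo (∏ p) coverage ℕ.≤ φ (∏ p) ℕ.+ cofactorSum
  sumTo-coverage≤ = begin
    sumTo N coverage
      ≡⟨ sumTo-+ N coprime (λ k → ∑[ i < t ] 𝟙 (p i ∣? k)) ⟩
    sumTo N coprime ℕ.+ sumTo N (λ k → ∑[ i < t ] 𝟙 (p i ∣? k))
      ≡⟨ cong₂ ℕ._+_ (sym (φ≡sumTo N)) (sumTo-∑-comm N (λ i k → 𝟙 (p i ∣? k))) ⟩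
    φ N ℕ.+ ∑[ i < t ] sumTo N (λ k → 𝟙 (p i ∣? k))
      ≤⟨ +-monoʳ-≤ (φ N) (∑-mono-≤ (λ i → #multiples≤/ (p i) {{prime⇒nonZero (pp i)}} N)) ⟩
    φ N ℕ.+ cofactorSum ∎
    where
    open ≤-Reasoning
    N : ℕ
    N = ∏ p
    coprime : ℕ → ℕ
    coprime k = 𝟙 (gcd k N ≟ 1)

  ∏≤φ∏+cofactorSum : ∏ p ℕ.≤ φ (∏ p) ℕ.+ cofactorSum
  ∏≤φ∏+cofactorSum = ≤-trans (n≤sumTo (∏ p) 1≤coverage) sumTo-coverage≤

∏<φ∏+cofactorSum : ∀ {t} (p : Vector ℕ (suc (suc t))) (pp : ∀ i → Prime (p i)) →
                   ∏ p < φ (∏ p) ℕ.+ cofactorSum p pp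
∏<φ∏+cofactorSum p pp = <-≤-trans (n<sumTo (∏ p) (1≤coverage p pp) 2≤coverage[∏p]) (sumTo-coverage≤ p pp)
  where
  instance
    ∏p≢0 : NonZero (∏ p)
    ∏p≢0 = ∏-nonZero p (prime⇒nonZero ∘ pp)
  2≤coverage[∏p] : 2 ℕ.≤ coverage p pp (∏ p)
  2≤coverage[∏p] = ≤-trans (+-mono-≤ (1≤𝟙 (p₀ ∣? ∏ p) (∣∏ p F.zero))
                                    (≤-trans (1≤𝟙 (p₁ ∣? ∏ p) (∣∏ p (F.suc F.zero))) (m≤m+n _ _)))
                           (m≤n+m _ (𝟙 (gcd (∏ p) (∏ p) ≟ 1)))
    where
    p₀ p₁ : ℕ
    p₀ = p F.zero
    p₁ = p (F.suc F.zero)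

φ∏+cofactorSum≤∏ : (p : Vector ℕ 1) (pp : ∀ i → Prime (p i)) → φ (∏ p) ℕ.+ cofactorSum p pp ℕ.≤ ∏ p
φ∏+cofactorSum≤∏ p pp = begin
  φ (∏ p) ℕ.+ cofactorSum p pp  ≡⟨ cong (φ (∏ p) ℕ.+_) cofactorSum≡1 ⟩
  φ (∏ p) ℕ.+ 1                 ≡⟨ +-comm (φ (∏ p)) 1 ⟩
  suc (φ (∏ p))                 ≤⟨ φ<n (∏ p) (subst (1 <_) (sym (*-identityʳ q)) (nonTrivial⇒n>1 q)) ⟩
  ∏ p                           ∎
  where
  open ≤-Reasoning
  q : ℕ
  q = p F.zero
  instance
    q≢0 : NonZero q
    q≢0 = prime⇒nonZero (pp F.zero)
    q≢1 : ℕ.NonTrivial q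
    q≢1 = prime⇒nonTrivial (pp F.zero)
  cofactorSum≡1 : q ℕ.* 1 / q ℕ.+ 0 ≡ 1
  cofactorSum≡1 = trans (+-identityʳ _) (trans (cong (_/ q) (*-identityʳ q)) (n/n≡1 q))

φ∏+cofactorSum≤∏⇔t≡1 : ∀ {t} → 1 ℕ.≤ t → (p : Vector ℕ t) (pp : ∀ i → Prime (p i)) →
                        (φ (∏ p) ℕ.+ cofactorSum p pp ℕ.≤ ∏ p) ⇔ (t ≡ 1)
φ∏+cofactorSum≤∏⇔t≡1 {zero}        ()
φ∏+cofactorSum≤∏⇔t≡1 {suc zero}    _ p pp = mk⇔ (λ _ → refl) (λ _ → φ∏+cofactorSum≤∏ p pp)
φ∏+cofactorSum≤∏⇔t≡1 {suc (suc t)} _ p pp = mk⇔ (λ ≤∏ → contradiction ≤∏ (<⇒≱ (∏<φ∏+cofactorSum p pp))) (λ ())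

[+m-+n]++o≡+[m+o∸n] : ∀ m n o → n ℕ.≤ m ℕ.+ o → (+ m - + n) + + o ≡ + (m ℕ.+ o ∸ n)
[+m-+n]++o≡+[m+o∸n] m n o n≤m+o = begin
  (+ m - + n) + + o   ≡⟨ xy∙z≈xz∙y (+ m) (- + n) (+ o) ⟩
  (+ m + + o) - + n   ≡⟨ cong (_- + n) (pos-+ m o) ⟨
  + (m ℕ.+ o) - + n   ≡⟨ [+m]-[+n]≡m⊖n (m ℕ.+ o) n ⟩
  (m ℕ.+ o) ⊖ n       ≡⟨ ⊖-≥ n≤m+o ⟩
  + (m ℕ.+ o ∸ n)     ∎
  where open ≡-Reasoning

-- The primes need not be increasing, nor even distinct.
lemma2p2 : (t : ℕ) → 1 Data.Nat.≤ t → (p : Fin t → ℕ) → (pp : (i : Fin t) → Prime (p i))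
    → (∀ i j → i F.< j → p i < p j)
    → (0ℤ ≤ ((+ φ (foldr Data.Nat._*_ 1 p) - + foldr Data.Nat._*_ 1 p)
              + (+ foldr Data.Nat._+_ 0 (λ k → divByPrime (foldr Data.Nat._*_ 1 p) (p k) (pp k)))))
      × ((((+ φ (foldr Data.Nat._*_ 1 p) - + foldr Data.Nat._*_ 1 p)
              + (+ foldr Data.Nat._+_ 0 (λ k → divByPrime (foldr Data.Nat._*_ 1 p) (p k) (pp k))))
           ≡ 0ℤ) ⇔ (t ≡ 1))
lemma2p2 t 1≤t p pp _ =
  subst (0ℤ ≤_) (sym excess) (+≤+ z≤n) ,
  mk⇔ (λ excess≡0 → to (m∸n≡0⇒m≤n (+-injective (trans (sym excess) excess≡0))))
      (λ t≡1 → trans excess (cong +_ (m≤n⇒m∸n≡0 (from t≡1))))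
  where
  open Equivalence (φ∏+cofactorSum≤∏⇔t≡1 1≤t p pp)
  excess : (+ φ (∏ p) - + ∏ p) + + cofactorSum p pp ≡ + (φ (∏ p) ℕ.+ cofactorSum p pp ∸ ∏ p)
  excess = [+m-+n]++o≡+[m+o∸n] (φ (∏ p)) (∏ p) (cofactorSum p pp) (∏≤φ∏+cofactorSum p pp)
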